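{- Let $k\ge 0$, let $q_1,\dots,q_k$ be distinct odd primes and $z=2\prod_{i=1}^k q_i$. Then $$|A(z)|=\sum_{j=0}^{k-2}(-1)^{k-2-j}\,a_j\,N(z,j),\qquad a_j=3^{k-j}-2^{k-j+1}+1,$$ where an empty sum is $0$.
   Context: For an integer $m>0$, $A(m)=\{x\in\mathbb{Z}: 0<x<m,\ \gcd(x,m)=1,\ \gcd(x-2,m)>1,\ \gcd(x+2,m)>1\}$. For $1\le j\le k$, $N(z,j)$ denotes the sum of all odd divisors $y$ of $z$ having exactly $j$ distinct prime factors (i.e. the sum of all products of $j$ distinct elements of $\{q_1,\dots,q_k\}$), and $N(z,0)=1$. -}

module Defs where

open import Data.Nat using (ℕ; zero; suc; _<_; _<?_; _≟_; ∣_-_∣)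
open import Data.Nat.Divisibility using (_∣_; _∣?_)
open import Data.Nat.GCD using (gcd)
open import Data.Nat.Primality using (Prime; prime?)
open import Data.List using (List; filter; length; upTo; map)
open import Data.Nat.ListAction using (sum)
open import Data.Product using (_×_)
open import Relation.Nullary using (¬_)
open import Relation.Nullary.Decidable using (_×-dec_; ¬?)
open import Relation.Binary.PropositionalEquality using (_≡_)
import Data.Integer as ℤ
open ℤ using (ℤ; +_)

-- A(m) = { x : 0 < x < m, gcd(x,m)=1, gcd(x-2,m)>1, gcd(x+2,m)>1 }, as a list.
-- gcd(x-2,m) is gcd(|x-2|,m) (gcd of integers depends only on absolute values).
A-list : ℕ → List ℕ
A-list m = filter (λ x → (0 <? x) ×-dec (gcd x m ≟ 1) ×-dec (1 <? gcd ∣ x - 2 ∣ m) ×-dec (1 <? gcd (x Data.Nat.+ 2) m))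
                  (upTo m)

cardA : ℕ → ℕ
cardA m = length (A-list m)

ω : ℕ → ℕ
ω y = length (filter (λ p → prime? p ×-dec (p ∣? y)) (upTo (suc y)))

N : ℕ → ℕ → ℕ
N z j = sum (filter (λ y → (0 <? y) ×-dec (y ∣? z) ×-dec ¬? (2 ∣? y) ×-dec (ω y ≟ j)) (upTo (suc z)))

a : ℕ → ℕ → ℤ
a k j = ((+ 3) ℤ.^ (k Data.Nat.∸ j)) ℤ.- ((+ 2) ℤ.^ suc (k Data.Nat.∸ j)) ℤ.+ (+ 1)

-- RHS: sum_{j=0}^{k-2} (-1)^(k-2-j) a_j N(z,j); empty (= 0) when k < 2
rhs : ℕ → ℕ → ℤ
rhs k z = Data.List.foldr ℤ._+_ (+ 0)
  (map (λ j → (ℤ.- (+ 1)) ℤ.^ (k Data.Nat.∸ 2 Data.Nat.∸ j) ℤ.* a k j ℤ.* (+ N z j))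
       (upTo (k Data.Nat.∸ 1)))

-- Write z = 2Q with Q = q₁⋯q_k. An x prime to z lies in A(z) unless x − 2 or x + 2 is prime
-- to z as well, so by inclusion–exclusion |A(z)| = #U − #(U ∩ U₋) − #(U ∩ U₊) + #(U ∩ U₋ ∩ U₊),
-- where U, U₋, U₊ collect the x < z with x, x − 2, x + 2 prime to z. Each of these is a
-- condition on the residues of x modulo the primes dividing z, so by the Chinese remainder
-- theorem each count is a product of local counts: an odd prime q leaves q − 1, q − 2, q − 2,
-- q − 3 residues (0, 2 and −2 are distinct modulo q) and the prime 2 leaves one. Hence
-- |A(z)| = ∏(qᵢ − 1) + ∏(qᵢ − 3) − 2∏(qᵢ − 2). The odd divisors of z with j prime factors are
-- the products of j of the qᵢ, so N(z, j) is the elementary symmetric function eⱼ(q), and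
-- expanding ∏(qᵢ − c) = Σⱼ (−c)^(k−j) eⱼ gives eⱼ the coefficient
-- (−1)^(k−j) (3^(k−j) − 2^(k−j+1) + 1), which vanishes for j ≥ k − 1.

module Submission where

open import Data.Bool.Base using (if_then_else_)
open import Data.Fin.Base as Fin using (Fin; toℕ; fromℕ<; punchOut)
import Data.Fin.Properties as Fin
open import Data.List.Base using (List; []; _∷_; length; map; applyUpTo; filter)
open import Data.List.Relation.Unary.All as All using (All; []; _∷_; all?)
open import Data.List.Relation.Unary.All.Properties using (All¬⇒¬Any)
open import Data.List.Relation.Unary.AllPairs using (AllPairs; []; _∷_)
open import Data.List.Relation.Unary.Any using (here; there)
open import Data.List.Relation.Unary.Unique.Propositional using (Unique)
open import Data.Nat.ListAction using (sum; product)
open import Data.Product.Base using (∃; _×_; _,_; proj₁; proj₂; uncurry)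
open import Data.Product.Function.NonDependent.Propositional using (_×-⇔_)
open import Data.Sum.Base using (_⊎_; inj₁; inj₂; [_,_])
open import Function.Base using (_∘_; id)
open import Function.Bundles using (_⇔_; mk⇔; Equivalence)
open import Function.Definitions using (Injective)
open import Function.Related.TypeIsomorphisms using (¬-cong-⇔)
open import Relation.Nullary using (Dec; yes; no; does; ¬_; contradiction)
open import Relation.Nullary.Decidable using (_×-dec_; ¬?)
open import Relation.Unary using (Pred; Decidable)
open import Relation.Binary.PropositionalEquality
  using (_≡_; _≢_; refl; sym; trans; cong; cong₂; subst; module ≡-Reasoning)

module Counting where

  open import Data.Nat.Base
  open import Data.Nat.Properties
  open import Data.Nat.Coprimality using (Coprime; coprime-divisor; coprime⇒gcd≡1)
  open import Data.Nat.Divisibility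
  open import Data.Nat.DivMod
  open import Data.Nat.GCD using (gcd; gcd-greatest; gcd[m,n]≡0⇒n≡0)
  open import Data.Nat.ListAction.Properties using (∈⇒∣product)
  open import Data.Nat.Primality
    using (Prime; prime?; prime[2]; ¬prime[0]; ¬prime[1]; euclidsLemma; prime⇒irreducible;
           prime⇒nonZero; productOfPrimes≢0; productOfPrimes≥1)
  open import Data.Nat.Tactic.RingSolver using (solve-∀)
  open import Data.List.Membership.DecPropositional _≟_ using (_∉_; _∈?_)
  open import Defs using (cardA; ω; N)

  -- Indicators and finite sums

  𝟙 : ∀ {a} {A : Set a} → Dec A → ℕ
  𝟙 a? = if does a? then 1 else 0

  𝟙-cong : ∀ {a b} {A : Set a} {B : Set b} → A ⇔ B → (a? : Dec A) (b? : Dec B) → 𝟙 a? ≡ 𝟙 b?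
  𝟙-cong A⇔B (yes a) (yes b) = refl
  𝟙-cong A⇔B (yes a) (no ¬b) = contradiction (Equivalence.to A⇔B a) ¬b
  𝟙-cong A⇔B (no ¬a) (yes b) = contradiction (Equivalence.from A⇔B b) ¬a
  𝟙-cong A⇔B (no ¬a) (no ¬b) = refl

  𝟙-no : ∀ {a} {A : Set a} → ¬ A → (a? : Dec A) → 𝟙 a? ≡ 0
  𝟙-no ¬a (yes a) = contradiction a ¬a
  𝟙-no ¬a (no _)  = refl

  𝟙-× : ∀ {a b} {A : Set a} {B : Set b} (a? : Dec A) (b? : Dec B) → 𝟙 (a? ×-dec b?) ≡ 𝟙 a? * 𝟙 b?
  𝟙-× (yes _) (yes _) = refl
  𝟙-× (yes _) (no _)  = refl
  𝟙-× (no _)  _       = refl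

  𝟙-split : ∀ {a b} {A : Set a} {B : Set b} (b? : Dec B) (a? : Dec A) →
            𝟙 a? ≡ 𝟙 (¬? b? ×-dec a?) + 𝟙 (b? ×-dec a?)
  𝟙-split (yes _) (yes _) = refl
  𝟙-split (yes _) (no _)  = refl
  𝟙-split (no _)  (yes _) = refl
  𝟙-split (no _)  (no _)  = refl

  𝟙-⊎ : ∀ {a b c} {A : Set a} {B : Set b} {C : Set c} → A ⇔ (B ⊎ C) → (B → ¬ C) →
        (a? : Dec A) (b? : Dec B) (c? : Dec C) → 𝟙 a? ≡ 𝟙 b? + 𝟙 c?
  𝟙-⊎ A⇔B⊎C disjoint (yes a) (yes b) (yes c) = contradiction c (disjoint b)
  𝟙-⊎ A⇔B⊎C disjoint (yes a) (yes b) (no _)  = refl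
  𝟙-⊎ A⇔B⊎C disjoint (yes a) (no _)  (yes c) = refl
  𝟙-⊎ A⇔B⊎C disjoint (yes a) (no ¬b) (no ¬c) = contradiction (Equivalence.to A⇔B⊎C a) [ ¬b , ¬c ]
  𝟙-⊎ A⇔B⊎C disjoint (no ¬a) (yes b) _       = contradiction (Equivalence.from A⇔B⊎C (inj₁ b)) ¬a
  𝟙-⊎ A⇔B⊎C disjoint (no ¬a) (no _)  (yes c) = contradiction (Equivalence.from A⇔B⊎C (inj₂ c)) ¬a
  𝟙-⊎ A⇔B⊎C disjoint (no ¬a) (no _)  (no _)  = refl

  inclusion-exclusion : ∀ {a b c} {A : Set a} {B : Set b} {C : Set c} (a? : Dec A) (b? : Dec B) (c? : Dec C) →
    𝟙 (a? ×-dec ¬? b? ×-dec ¬? c?) + 𝟙 (a? ×-dec b?) + 𝟙 (a? ×-dec c?) ≡ 𝟙 a? + 𝟙 (a? ×-dec b? ×-dec c?)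
  inclusion-exclusion (yes _) (yes _) (yes _) = refl
  inclusion-exclusion (yes _) (yes _) (no _)  = refl
  inclusion-exclusion (yes _) (no _)  (yes _) = refl
  inclusion-exclusion (yes _) (no _)  (no _)  = refl
  inclusion-exclusion (no _)  _       _       = refl

  ∑< : ℕ → (ℕ → ℕ) → ℕ
  ∑< zero    f = 0
  ∑< (suc n) f = f 0 + ∑< n (f ∘ suc)

  syntax ∑< n (λ x → e) = ∑[ x < n ] e

  ∑-cong : ∀ n {f g : ℕ → ℕ} → (∀ {x} → x < n → f x ≡ g x) → ∑< n f ≡ ∑< n g
  ∑-cong zero    eq = refl
  ∑-cong (suc n) eq = cong₂ _+_ (eq z<s) (∑-cong n (eq ∘ s<s))

  ∑-zero : ∀ n {f : ℕ → ℕ} → (∀ {x} → x < n → f x ≡ 0) → ∑< n f ≡ 0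
  ∑-zero zero    eq = refl
  ∑-zero (suc n) eq rewrite eq z<s = ∑-zero n (eq ∘ s<s)

  ∑-distrib-+ : ∀ n (f g : ℕ → ℕ) → ∑[ x < n ] (f x + g x) ≡ ∑< n f + ∑< n g
  ∑-distrib-+ zero    f g = refl
  ∑-distrib-+ (suc n) f g rewrite ∑-distrib-+ n (f ∘ suc) (g ∘ suc) =
    interchange (f 0) (g 0) (∑< n (f ∘ suc)) (∑< n (g ∘ suc))
    where
    interchange : ∀ a b c d → a + b + (c + d) ≡ a + c + (b + d)
    interchange = solve-∀

  ∑-*ˡ : ∀ n c (f : ℕ → ℕ) → ∑[ x < n ] (c * f x) ≡ c * ∑< n f
  ∑-*ˡ zero    c f = sym (*-zeroʳ c)
  ∑-*ˡ (suc n) c f rewrite ∑-*ˡ n c (f ∘ suc) = sym (*-distribˡ-+ c (f 0) (∑< n (f ∘ suc)))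

  ∑-*ʳ : ∀ n c (f : ℕ → ℕ) → ∑[ x < n ] (f x * c) ≡ ∑< n f * c
  ∑-*ʳ zero    c f = refl
  ∑-*ʳ (suc n) c f rewrite ∑-*ʳ n c (f ∘ suc) = sym (*-distribʳ-+ c (f 0) (∑< n (f ∘ suc)))

  ∑-split : ∀ m n (f : ℕ → ℕ) → ∑< (m + n) f ≡ ∑< m f + ∑[ x < n ] f (m + x)
  ∑-split zero    n f = refl
  ∑-split (suc m) n f rewrite ∑-split m n (f ∘ suc) = sym (+-assoc (f 0) _ _)

  ∑-truncate : ∀ {m n} {f : ℕ → ℕ} → m ≤ n → (∀ {x} → m ≤ x → x < n → f x ≡ 0) → ∑< n f ≡ ∑< m f
  ∑-truncate {m} {n} {f} m≤n vanish = begin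
    ∑< n f                               ≡⟨ cong (λ k → ∑< k f) (sym (m+[n∸m]≡n m≤n)) ⟩
    ∑< (m + (n ∸ m)) f                   ≡⟨ ∑-split m (n ∸ m) f ⟩
    ∑< m f + ∑[ x < n ∸ m ] f (m + x)    ≡⟨ cong (∑< m f +_) (∑-zero (n ∸ m) tail) ⟩
    ∑< m f + 0                           ≡⟨ +-identityʳ _ ⟩
    ∑< m f                               ∎
    where
    open ≡-Reasoning
    tail : ∀ {x} → x < n ∸ m → f (m + x) ≡ 0
    tail {x} x<n∸m = vanish (m≤m+n m x) (subst (m + x <_) (m+[n∸m]≡n m≤n) (+-monoʳ-< m x<n∸m))

  ∑-comm : ∀ m n (f : ℕ → ℕ → ℕ) → ∑[ x < m ] ∑[ y < n ] f x y ≡ ∑[ y < n ] ∑[ x < m ] f x y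
  ∑-comm zero    n f = sym (∑-zero n (λ _ → refl))
  ∑-comm (suc m) n f rewrite ∑-comm m n (f ∘ suc) = sym (∑-distrib-+ n (f 0) (λ y → ∑[ x < m ] f (suc x) y))

  ∑-blocks : ∀ m n (f : ℕ → ℕ) → ∑< (m * n) f ≡ ∑[ t < m ] ∑[ r < n ] f (t * n + r)
  ∑-blocks zero    n f = refl
  ∑-blocks (suc m) n f = begin
    ∑< (n + m * n) f                                       ≡⟨ ∑-split n (m * n) f ⟩
    ∑< n f + ∑[ x < m * n ] f (n + x)                      ≡⟨ cong (∑< n f +_) (∑-blocks m n (λ x → f (n + x))) ⟩
    ∑< n f + ∑[ t < m ] ∑[ r < n ] f (n + (t * n + r))     ≡⟨ cong (∑< n f +_) (∑-cong m λ _ → ∑-cong n λ _ →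
                                                               cong f (sym (+-assoc n _ _))) ⟩
    ∑< n f + ∑[ t < m ] ∑[ r < n ] f (n + t * n + r)       ∎
    where open ≡-Reasoning

  ∑-multiples : ∀ m n .{{_ : NonZero n}} {f : ℕ → ℕ} → (∀ {x} → ¬ n ∣ x → f x ≡ 0) →
                ∑< (m * n) f ≡ ∑[ t < m ] f (t * n)
  ∑-multiples m n@(suc n-1) {f} vanish = trans (∑-blocks m n f) (∑-cong m λ {t} _ → begin
    f (t * n + 0) + ∑[ r < n-1 ] f (t * n + suc r)   ≡⟨ cong₂ _+_ (cong f (+-identityʳ _)) (∑-zero n-1 (off {t})) ⟩
    f (t * n) + 0                                    ≡⟨ +-identityʳ _ ⟩
    f (t * n)                                        ∎)
    where
    open ≡-Reasoning
    off : ∀ {t r} → r < n-1 → f (t * n + suc r) ≡ 0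
    off {t} {r} r<n-1 = vanish λ n∣ → <⇒≱ (s<s r<n-1) (∣⇒≤ (∣m+n∣m⇒∣n n∣ (n∣m*n t)))

  ∑-𝟙-≟ : ∀ n {a} → a < n → ∑[ x < n ] 𝟙 (x ≟ a) ≡ 1
  ∑-𝟙-≟ (suc n) {zero}  _ = cong suc (∑-zero n λ _ → refl)
  ∑-𝟙-≟ (suc n) {suc a} (s<s a<n) = ∑-𝟙-≟ n a<n

  ∑-pick : ∀ n {a} (f : ℕ → ℕ) → a < n → ∑[ x < n ] (f x * 𝟙 (x ≟ a)) ≡ f a
  ∑-pick (suc n) {zero}  f _ = begin
    f 0 * 1 + ∑[ x < n ] (f (suc x) * 0)  ≡⟨ cong₂ _+_ (*-identityʳ (f 0)) (∑-zero n λ {x} _ → *-zeroʳ (f (suc x))) ⟩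
    f 0 + 0                               ≡⟨ +-identityʳ (f 0) ⟩
    f 0                                   ∎
    where open ≡-Reasoning
  ∑-pick (suc n) {suc a} f (s<s a<n) =
    trans (cong (_+ ∑[ x < n ] (f (suc x) * 𝟙 (x ≟ a))) (*-zeroʳ (f 0))) (∑-pick n (f ∘ suc) a<n)

  injective⇒surjective : ∀ {n} {f : Fin n → Fin n} → Injective _≡_ _≡_ f → ∀ s → ∃ λ t → f t ≡ s
  injective⇒surjective {suc n} {f} f-inj s with Fin.any? (λ t → f t Fin.≟ s)
  ... | yes hit = hit
  ... | no  miss = contradiction (Fin.injective⇒≤ punch-injective) 1+n≰n
    where
    punch : Fin (suc n) → Fin n
    punch t = punchOut {i = s} {j = f t} λ s≡ft → miss (t , sym s≡ft)
    punch-injective : Injective _≡_ _≡_ punch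
    punch-injective {t} {u} eq = f-inj (Fin.punchOut-injective {i = s} _ _ eq)

  module _ {n} {σ : ℕ → ℕ} (into : ∀ {t} → t < n → σ t < n)
           (inj : ∀ {t u} → t < n → u < n → σ t ≡ σ u → t ≡ u) where

    preimage : ∀ {s} → s < n → ∃ λ t → t < n × σ t ≡ s
    preimage {s} s<n =
      let t , σ′t≡s = injective⇒surjective σ′-injective (fromℕ< s<n)
      in toℕ t , Fin.toℕ<n t , trans (sym (Fin.toℕ-fromℕ< _)) (trans (cong toℕ σ′t≡s) (Fin.toℕ-fromℕ< s<n))
      where
      σ′ : Fin n → Fin n
      σ′ i = fromℕ< (into (Fin.toℕ<n i))
      σ′-injective : Injective _≡_ _≡_ σ′
      σ′-injective {i} {j} eq = Fin.toℕ-injective (inj (Fin.toℕ<n i) (Fin.toℕ<n j)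
        (Fin.fromℕ<-injective _ _ (into (Fin.toℕ<n i)) (into (Fin.toℕ<n j)) eq))

    ∑-reindex : ∀ (f : ℕ → ℕ) → ∑[ t < n ] f (σ t) ≡ ∑< n f
    ∑-reindex f = begin
      ∑[ t < n ] f (σ t)                         ≡⟨ ∑-cong n (λ t<n → sym (∑-pick n f (into t<n))) ⟩
      ∑[ t < n ] ∑[ s < n ] (f s * 𝟙 (s ≟ σ t))  ≡⟨ ∑-comm n n _ ⟩
      ∑[ s < n ] ∑[ t < n ] (f s * 𝟙 (s ≟ σ t))  ≡⟨ ∑-cong n (λ {s} s<n → trans (∑-*ˡ n (f s) _)
                                                      (cong (f s *_) (unique-preimage s<n))) ⟩
      ∑[ s < n ] (f s * 1)                       ≡⟨ ∑-cong n (λ {s} _ → *-identityʳ (f s)) ⟩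
      ∑< n f                                     ∎
      where
      open ≡-Reasoning
      unique-preimage : ∀ {s} → s < n → ∑[ t < n ] 𝟙 (s ≟ σ t) ≡ 1
      unique-preimage {s} s<n with t₀ , t₀<n , σt₀≡s ← preimage s<n = trans
        (∑-cong n λ {t} t<n → 𝟙-cong (mk⇔ (λ s≡σt → inj t<n t₀<n (trans (sym s≡σt) (sym σt₀≡s)))
                                          (λ { refl → sym σt₀≡s })) (s ≟ σ t) (t ≟ t₀))
        (∑-𝟙-≟ n t₀<n)

  length-filter : ∀ {p} {P : Pred ℕ p} (P? : Decidable P) (f : ℕ → ℕ) n →
                  length (filter P? (applyUpTo f n)) ≡ ∑[ x < n ] 𝟙 (P? (f x))
  length-filter P? f zero = refl
  length-filter P? f (suc n) with P? (f 0)
  ... | yes _ = cong suc (length-filter P? (f ∘ suc) n)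
  ... | no  _ = length-filter P? (f ∘ suc) n

  sum-filter : ∀ {p} {P : Pred ℕ p} (P? : Decidable P) (f : ℕ → ℕ) n →
               sum (filter P? (applyUpTo f n)) ≡ ∑[ x < n ] (𝟙 (P? (f x)) * f x)
  sum-filter P? f zero = refl
  sum-filter P? f (suc n) with P? (f 0)
  ... | yes _ = cong₂ _+_ (sym (+-identityʳ (f 0))) (sum-filter P? (f ∘ suc) n)
  ... | no  _ = sum-filter P? (f ∘ suc) n

  ∑-∉ : ∀ n {F} → Unique F → All (_< n) F → ∑[ s < n ] 𝟙 (¬? (s ∈? F)) + length F ≡ n
  ∑-∉ n {[]}    []               []            = trans (+-identityʳ _) (∑-1 n)
    where
    ∑-1 : ∀ n → ∑[ s < n ] 1 ≡ n
    ∑-1 zero    = refl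
    ∑-1 (suc n) = cong suc (∑-1 n)
  ∑-∉ n {a ∷ F} (a∉F ∷ unique) (a<n ∷ F<n) = begin
    ∑[ s < n ] 𝟙 (¬? (s ∈? a ∷ F)) + suc (length F)
      ≡⟨ +-suc _ _ ⟩
    suc (∑[ s < n ] 𝟙 (¬? (s ∈? a ∷ F))) + length F
      ≡⟨ cong (_+ length F) (+-comm 1 _) ⟩
    ∑[ s < n ] 𝟙 (¬? (s ∈? a ∷ F)) + 1 + length F
      ≡⟨ cong (λ k → ∑< n _ + k + length F) (sym (∑-𝟙-≟ n a<n)) ⟩
    ∑[ s < n ] 𝟙 (¬? (s ∈? a ∷ F)) + ∑[ s < n ] 𝟙 (s ≟ a) + length F ≡⟨ cong (_+ length F) (sym (∑-distrib-+ n _ _)) ⟩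
    ∑[ s < n ] (𝟙 (¬? (s ∈? a ∷ F)) + 𝟙 (s ≟ a)) + length F
      ≡⟨ cong (_+ length F) (∑-cong n λ {s} _ → sym (split s)) ⟩
    ∑[ s < n ] 𝟙 (¬? (s ∈? F)) + length F
      ≡⟨ ∑-∉ n unique F<n ⟩
    n ∎
    where
    open ≡-Reasoning
    split : ∀ s → 𝟙 (¬? (s ∈? F)) ≡ 𝟙 (¬? (s ∈? a ∷ F)) + 𝟙 (s ≟ a)
    split s = 𝟙-⊎ (mk⇔ to from) (λ s∉a∷F s≡a → s∉a∷F (here s≡a))
                (¬? (s ∈? F)) (¬? (s ∈? a ∷ F)) (s ≟ a)
      where
      to : s ∉ F → s ∉ a ∷ F ⊎ s ≡ a
      to s∉F with s ≟ a
      ... | yes s≡a = inj₂ s≡a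
      ... | no  s≢a = inj₁ λ { (here s≡a) → s≢a s≡a ; (there s∈F) → s∉F s∈F }
      from : s ∉ a ∷ F ⊎ s ≡ a → s ∉ F
      from (inj₁ s∉a∷F) = s∉a∷F ∘ there
      from (inj₂ refl)  = All¬⇒¬Any a∉F

  ∉-[_]⇔ : ∀ {ℓ} {x a} {P : Set ℓ} → P ⇔ (x ≡ a) → (¬ P) ⇔ (x ∉ a ∷ [])
  ∉-[ P⇔x≡a ]⇔ = mk⇔ (λ { ¬P (here x≡a) → ¬P (Equivalence.from P⇔x≡a x≡a) })
                     (λ x∉ p → x∉ (here (Equivalence.to P⇔x≡a p)))

  ∉-∷⇔ : ∀ {ℓ ℓ′} {x a F} {P : Set ℓ} {C : Set ℓ′} → P ⇔ (x ≡ a) → C ⇔ (x ∉ F) → (¬ P × C) ⇔ (x ∉ a ∷ F)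
  ∉-∷⇔ P⇔x≡a C⇔x∉F = mk⇔
    (λ { (¬P , c) (here x≡a)  → ¬P (Equivalence.from P⇔x≡a x≡a)
       ; (¬P , c) (there x∈F) → Equivalence.to C⇔x∉F c x∈F })
    (λ x∉ → (λ p → x∉ (here (Equivalence.to P⇔x≡a p))) , Equivalence.from C⇔x∉F (x∉ ∘ there))

  ∑-avoiding : ∀ n {C : ℕ → Set} (C? : Decidable C) F → Unique F → All (_< n) F →
               (∀ {s} → s < n → C s ⇔ s ∉ F) → ∑[ s < n ] 𝟙 (C? s) ≡ n ∸ length F
  ∑-avoiding n C? F unique F<n C⇔∉F = begin
    ∑[ s < n ] 𝟙 (C? s)                            ≡⟨ ∑-cong n (λ {s} s<n → 𝟙-cong (C⇔∉F s<n) (C? s) (¬? (s ∈? F))) ⟩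
    ∑[ s < n ] 𝟙 (¬? (s ∈? F))                     ≡⟨ sym (m+n∸n≡m _ (length F)) ⟩
    ∑[ s < n ] 𝟙 (¬? (s ∈? F)) + length F ∸ length F ≡⟨ cong (_∸ length F) (∑-∉ n unique F<n) ⟩
    n ∸ length F                                   ∎
    where open ≡-Reasoning

  -- The Chinese remainder theorem

  m%n≡o%n⇒n∣m∸o : ∀ m o n .{{_ : NonZero n}} → m % n ≡ o % n → n ∣ m ∸ o
  m%n≡o%n⇒n∣m∸o m o n eq = divides (m / n ∸ o / n) (begin
    m ∸ o                                  ≡⟨ cong₂ _∸_ (m≡m%n+[m/n]*n m n) (m≡m%n+[m/n]*n o n) ⟩
    (m % n + m / n * n) ∸ (o % n + o / n * n) ≡⟨ cong (λ k → (k + m / n * n) ∸ (o % n + o / n * n)) eq ⟩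
    (o % n + m / n * n) ∸ (o % n + o / n * n) ≡⟨ [m+n]∸[m+o]≡n∸o (o % n) _ _ ⟩
    m / n * n ∸ o / n * n                  ≡⟨ sym (*-distribʳ-∸ n (m / n) (o / n)) ⟩
    (m / n ∸ o / n) * n                    ∎)
    where open ≡-Reasoning

  n∣m∸o⇒m%n≡o%n : ∀ {m o} n .{{_ : NonZero n}} → o ≤ m → n ∣ m ∸ o → m % n ≡ o % n
  n∣m∸o⇒m%n≡o%n {m} {o} n o≤m n∣m∸o = trans (cong (_% n) (sym (m+[n∸m]≡n o≤m))) (%-remove-+ʳ o n∣m∸o)

  m%n≡o%n⇔n∣∣m-o∣ : ∀ m o n .{{_ : NonZero n}} → m % n ≡ o % n ⇔ n ∣ ∣ m - o ∣
  m%n≡o%n⇔n∣∣m-o∣ m o n with ≤-total o m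
  ... | inj₁ o≤m rewrite m≤n⇒∣n-m∣≡n∸m o≤m = mk⇔ (m%n≡o%n⇒n∣m∸o m o n) (n∣m∸o⇒m%n≡o%n n o≤m)
  ... | inj₂ m≤o rewrite m≤n⇒∣m-n∣≡n∸m m≤o = mk⇔ (m%n≡o%n⇒n∣m∸o o m n ∘ sym) (sym ∘ n∣m∸o⇒m%n≡o%n n m≤o)

  ∣-<⇒≡0 : ∀ {n d} → n ∣ d → d < n → d ≡ 0
  ∣-<⇒≡0 {d = zero}  _   _   = refl
  ∣-<⇒≡0 {d = suc d} n∣d d<n = contradiction (∣⇒≤ n∣d) (<⇒≱ d<n)

  Periodic : ℕ → (ℕ → Set) → Set
  Periodic n C = ∀ t r → C (t * n + r) ⇔ C r

  periodic-% : ∀ {n C} .{{_ : NonZero n}} → Periodic n C → ∀ x → C x ⇔ C (x % n)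
  periodic-% {n} {C} periodic x =
    subst (λ y → C y ⇔ C (x % n)) (sym (trans (m≡m%n+[m/n]*n x n) (+-comm (x % n) _))) (periodic (x / n) (x % n))

  periodic-∣ : ∀ {m n C} → m ∣ n → Periodic m C → Periodic n C
  periodic-∣ {m} {C = C} (divides k refl) periodic t r =
    subst (λ y → C (y + r) ⇔ C r) (*-assoc t k m) (periodic (t * k) r)

  periodic-× : ∀ {n C D} → Periodic n C → Periodic n D → Periodic n (λ x → C x × D x)
  periodic-× C-periodic D-periodic t r = C-periodic t r ×-⇔ D-periodic t r

  periodic-¬ : ∀ {n C} → Periodic n C → Periodic n (¬_ ∘ C)
  periodic-¬ periodic t r = ¬-cong-⇔ (periodic t r)

  periodic-+ : ∀ {n C} a → Periodic n C → Periodic n (λ x → C (x + a))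
  periodic-+ {C = C} a periodic t r = subst (λ y → C y ⇔ C (r + a)) (sym (+-assoc _ r a)) (periodic t (r + a))

  ∣-periodic : ∀ n → Periodic n (n ∣_)
  ∣-periodic n t r = mk⇔ (λ n∣ → ∣m+n∣m⇒∣n n∣ (n∣m*n t)) (∣m∣n⇒∣m+n (n∣m*n t))

  coprime-product : ∀ {m L} → All (Coprime m) L → Coprime m (product L)
  coprime-product []          (_ , i∣1)   = ∣1⇒≡1 i∣1
  coprime-product (m⊥n ∷ m⊥L) (i∣m , i∣nL) =
    coprime-product m⊥L (i∣m , coprime-divisor (λ (j∣i , j∣n) → m⊥n (∣-trans j∣i i∣m , j∣n)) i∣nL)

  coprime⇒residues-injective : ∀ {m n} .{{_ : NonZero m}} → Coprime m n → ∀ {r t u} → t < m → u < m →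
                               (t * n + r) % m ≡ (u * n + r) % m → t ≡ u
  coprime⇒residues-injective {m} {n} m⊥n {r} t<m u<m eq = ≤-antisym (≤-from t<m eq) (≤-from u<m (sym eq))
    where
    open ≡-Reasoning
    difference : ∀ t u → (t * n + r) ∸ (u * n + r) ≡ n * (t ∸ u)
    difference t u = begin
      (t * n + r) ∸ (u * n + r) ≡⟨ cong₂ _∸_ (+-comm (t * n) r) (+-comm (u * n) r) ⟩
      (r + t * n) ∸ (r + u * n) ≡⟨ [m+n]∸[m+o]≡n∸o r _ _ ⟩
      t * n ∸ u * n             ≡⟨ sym (*-distribʳ-∸ n t u) ⟩
      (t ∸ u) * n               ≡⟨ *-comm (t ∸ u) n ⟩
      n * (t ∸ u)               ∎
    ≤-from : ∀ {t u} → t < m → (t * n + r) % m ≡ (u * n + r) % m → t ≤ u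
    ≤-from {t} {u} t<m eq = m∸n≡0⇒m≤n (∣-<⇒≡0
      (coprime-divisor m⊥n (subst (m ∣_) (difference t u) (m%n≡o%n⇒n∣m∸o _ _ m eq)))
      (≤-<-trans (m∸n≤m t u) t<m))

  -- As t runs below m, the residues (t n + r) mod m run through all residues once.
  ∑-coprime-product : ∀ {m n} .{{_ : NonZero m}} → Coprime m n → ∀ {H G : ℕ → Set} (H? : Decidable H) (G? : Decidable G) →
    Periodic m H → Periodic n G → ∑[ x < m * n ] 𝟙 (H? x ×-dec G? x) ≡ ∑[ s < m ] 𝟙 (H? s) * ∑[ r < n ] 𝟙 (G? r)
  ∑-coprime-product {m} {n} m⊥n {H} {G} H? G? H-periodic G-periodic = begin
    ∑[ x < m * n ] 𝟙 (H? x ×-dec G? x)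
      ≡⟨ ∑-blocks m n _ ⟩
    ∑[ t < m ] ∑[ r < n ] 𝟙 (H? (t * n + r) ×-dec G? (t * n + r))
      ≡⟨ ∑-cong m (λ {t} _ → ∑-cong n λ _ → separate {t}) ⟩
    ∑[ t < m ] ∑[ r < n ] (𝟙 (H? ((t * n + r) % m)) * 𝟙 (G? r))
      ≡⟨ ∑-comm m n _ ⟩
    ∑[ r < n ] ∑[ t < m ] (𝟙 (H? ((t * n + r) % m)) * 𝟙 (G? r))
      ≡⟨ ∑-cong n (λ {r} _ → ∑-*ʳ m (𝟙 (G? r)) _) ⟩
    ∑[ r < n ] (∑[ t < m ] 𝟙 (H? ((t * n + r) % m)) * 𝟙 (G? r))
      ≡⟨ ∑-cong n (λ {r} _ → cong (_* 𝟙 (G? r))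
           (∑-reindex (λ _ → m%n<n _ m) (coprime⇒residues-injective m⊥n) (λ s → 𝟙 (H? s)))) ⟩
    ∑[ r < n ] (∑[ s < m ] 𝟙 (H? s) * 𝟙 (G? r))
      ≡⟨ ∑-*ˡ n (∑[ s < m ] 𝟙 (H? s)) (λ r → 𝟙 (G? r)) ⟩
    ∑[ s < m ] 𝟙 (H? s) * ∑[ r < n ] 𝟙 (G? r) ∎
    where
    open ≡-Reasoning
    separate : ∀ {t r} → 𝟙 (H? (t * n + r) ×-dec G? (t * n + r)) ≡ 𝟙 (H? ((t * n + r) % m)) * 𝟙 (G? r)
    separate {t} {r} = trans
      (𝟙-cong (periodic-% H-periodic (t * n + r) ×-⇔ G-periodic t r)
              (H? (t * n + r) ×-dec G? (t * n + r)) (H? ((t * n + r) % m) ×-dec G? r))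
      (𝟙-× (H? ((t * n + r) % m)) (G? r))

  periodic-All : ∀ {L} {C : ℕ → ℕ → Set} → All (λ p → Periodic p (C p)) L →
                 Periodic (product L) (λ x → All (λ p → C p x) L)
  periodic-All []                                   t r = mk⇔ (λ _ → []) (λ _ → [])
  periodic-All {p ∷ L} (p-periodic ∷ L-periodic) t r =
    mk⇔ (λ { (c ∷ cs) → uncurry _∷_ (Equivalence.to (both t r) (c , cs)) })
        (λ { (c ∷ cs) → uncurry _∷_ (Equivalence.from (both t r) (c , cs)) })
    where
    both = periodic-× (periodic-∣ (m∣m*n (product L)) p-periodic) (periodic-∣ (n∣m*n p) (periodic-All L-periodic))

  ∑-chinese-remainder : ∀ {L} (C : ℕ → ℕ → Set) (C? : ∀ p → Decidable (C p)) →
    All NonZero L → AllPairs Coprime L → All (λ p → Periodic p (C p)) L →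
    ∑[ x < product L ] 𝟙 (all? (λ p → C? p x) L) ≡ product (map (λ p → ∑[ s < p ] 𝟙 (C? p s)) L)
  ∑-chinese-remainder {[]}    C C? [] [] [] = refl
  ∑-chinese-remainder {p ∷ L} C C? (p≢0 ∷ L≢0) (p⊥L ∷ L-coprime) (p-periodic ∷ L-periodic) =
    trans (∑-coprime-product {{p≢0}} (coprime-product p⊥L) (C? p) (λ x → all? (λ p → C? p x) L)
             p-periodic (periodic-All L-periodic))
          (cong (∑[ s < p ] 𝟙 (C? p s) *_) (∑-chinese-remainder C C? L≢0 L-coprime L-periodic))

  prime∤⇒coprime : ∀ {p y} → Prime p → ¬ p ∣ y → Coprime y p
  prime∤⇒coprime p-prime p∤y (i∣y , i∣p) with prime⇒irreducible p-prime i∣p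
  ... | inj₁ i≡1 = i≡1
  ... | inj₂ refl = contradiction i∣y p∤y

  prime≢1 : ∀ {p} → Prime p → p ≢ 1
  prime≢1 p-prime refl = ¬prime[1] p-prime

  primes-coprime : ∀ {p q} → Prime p → Prime q → p ≢ q → Coprime p q
  primes-coprime p-prime q-prime p≢q = prime∤⇒coprime q-prime λ q∣p →
    [ prime≢1 q-prime , (λ q≡p → p≢q (sym q≡p)) ] (prime⇒irreducible p-prime q∣p)

  distinct-with-2 : ∀ {qs} → All (λ q → ¬ 2 ∣ q) qs → AllPairs _≢_ qs → AllPairs _≢_ (2 ∷ qs)
  distinct-with-2 odd distinct = All.map (λ 2∤q 2≡q → 2∤q (subst (2 ∣_) 2≡q ∣-refl)) odd ∷ distinct

  distinct-primes-coprime : ∀ {L} → All Prime L → AllPairs _≢_ L → AllPairs Coprime L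
  distinct-primes-coprime []                   []                = []
  distinct-primes-coprime {p ∷ L} (p-prime ∷ primes) (p≢L ∷ distinct) =
    All.zipWith coprime (primes , p≢L) ∷ distinct-primes-coprime primes distinct
    where
    coprime : ∀ {q} → Prime q × p ≢ q → Coprime p q
    coprime (q-prime , p≢q) = primes-coprime p-prime q-prime p≢q

  coprime⇒∤ : ∀ {p n} → Prime p → Coprime p n → ¬ p ∣ n
  coprime⇒∤ p-prime p⊥n p∣n = prime≢1 p-prime (p⊥n (∣-refl , p∣n))

  gcd≡1⇔All∤ : ∀ {L} y → All Prime L → gcd y (product L) ≡ 1 ⇔ All (λ p → ¬ p ∣ y) L
  gcd≡1⇔All∤ {L} y primes = mk⇔
    (λ gcd≡1 → All.tabulate λ {p} p∈L p∣y →
       prime≢1 (All.lookup primes p∈L) (∣1⇒≡1 (subst (p ∣_) gcd≡1 (gcd-greatest p∣y (∈⇒∣product p∈L)))))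
    (λ avoids → coprime⇒gcd≡1 (coprime-product (All.zipWith coprime (primes , avoids))))
    where
    coprime : ∀ {p} → Prime p × ¬ p ∣ y → Coprime y p
    coprime (p-prime , p∤y) = prime∤⇒coprime p-prime p∤y

  1<⇔≢1 : ∀ {n} → n ≢ 0 → 1 < n ⇔ n ≢ 1
  1<⇔≢1 {n} n≢0 = mk⇔ (λ { 1<n refl → <-irrefl refl 1<n }) (from n n≢0)
    where
    from : ∀ n → n ≢ 0 → n ≢ 1 → 1 < n
    from 0             n≢0 _   = contradiction refl n≢0
    from 1             _   n≢1 = contradiction refl n≢1
    from (suc (suc _)) _   _   = s<s z<s

  1<gcd⇔¬All∤ : ∀ {L} w → All Prime L → 1 < gcd w (product L) ⇔ (¬ All (λ p → ¬ p ∣ w) L)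
  1<gcd⇔¬All∤ {L} w primes = mk⇔
    (λ 1<gcd avoids → Equivalence.to (1<⇔≢1 gcd≢0) 1<gcd (Equivalence.from (gcd≡1⇔All∤ w primes) avoids))
    (λ ¬avoids → Equivalence.from (1<⇔≢1 gcd≢0) (¬avoids ∘ Equivalence.to (gcd≡1⇔All∤ w primes)))
    where
    gcd≢0 : gcd w (product L) ≢ 0
    gcd≢0 gcd≡0 = ≢-nonZero⁻¹ (product L) {{productOfPrimes≢0 primes}} (gcd[m,n]≡0⇒n≡0 w gcd≡0)

  odd-prime⇒2< : ∀ {q} → Prime q → ¬ 2 ∣ q → 2 < q
  odd-prime⇒2< {0}                 p _   = contradiction p ¬prime[0]
  odd-prime⇒2< {1}                 p _   = contradiction p ¬prime[1]
  odd-prime⇒2< {2}                 _ odd = contradiction ∣-refl odd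
  odd-prime⇒2< {suc (suc (suc _))} _ _   = s<s (s<s z<s)

  Unit Unit₋ Unit₊ : ℕ → ℕ → Set
  Unit  p x = ¬ p ∣ x
  Unit₋ p x = ¬ p ∣ ∣ x - 2 ∣
  Unit₊ p x = ¬ p ∣ x + 2

  unit? : ∀ p → Decidable (Unit p)
  unit? p x = ¬? (p ∣? x)

  unit₋? : ∀ p → Decidable (Unit₋ p)
  unit₋? p x = ¬? (p ∣? ∣ x - 2 ∣)

  unit₊? : ∀ p → Decidable (Unit₊ p)
  unit₊? p x = ¬? (p ∣? x + 2)

  unit-unit₋? : ∀ p → Decidable (λ x → Unit p x × Unit₋ p x)
  unit-unit₋? p x = unit? p x ×-dec unit₋? p x

  unit-unit₊? : ∀ p → Decidable (λ x → Unit p x × Unit₊ p x)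
  unit-unit₊? p x = unit? p x ×-dec unit₊? p x

  unit-unit₋-unit₊? : ∀ p → Decidable (λ x → Unit p x × Unit₋ p x × Unit₊ p x)
  unit-unit₋-unit₊? p x = unit? p x ×-dec unit₋? p x ×-dec unit₊? p x

  unit-periodic : ∀ p → Periodic p (Unit p)
  unit-periodic p = periodic-¬ (∣-periodic p)

  unit₊-periodic : ∀ p → Periodic p (Unit₊ p)
  unit₊-periodic p = periodic-¬ (periodic-+ 2 (∣-periodic p))

  unit₋-periodic : ∀ p .{{_ : NonZero p}} → Periodic p (Unit₋ p)
  unit₋-periodic p = periodic-¬ λ t r →
    let shift = %-remove-+ˡ r (n∣m*n t)
        E y   = m%n≡o%n⇔n∣∣m-o∣ y 2 p
    in mk⇔ (λ h → Equivalence.to (E r) (trans (sym shift) (Equivalence.from (E (t * p + r)) h)))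
           (λ h → Equivalence.to (E (t * p + r)) (trans shift (Equivalence.from (E r) h)))

  ∣⇔≡0 : ∀ {q s} → s < q → q ∣ s ⇔ s ≡ 0
  ∣⇔≡0 s<q = mk⇔ (λ q∣s → ∣-<⇒≡0 q∣s s<q) λ { refl → divides 0 refl }

  module _ {q} (2<q : 2 < q) where

    ∣∣-2∣⇔≡2 : ∀ {s} → s < q → q ∣ ∣ s - 2 ∣ ⇔ s ≡ 2
    ∣∣-2∣⇔≡2 {s} s<q = mk⇔
      (λ q∣ → ∣m-n∣≡0⇒m≡n (∣-<⇒≡0 q∣ (≤-<-trans (∣m-n∣≤m⊔n s 2) (⊔-lub s<q 2<q))))
      λ { refl → divides 0 refl }

    ∣+2⇔≡q∸2 : ∀ {s} → s < q → q ∣ s + 2 ⇔ s ≡ q ∸ 2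
    ∣+2⇔≡q∸2 {s} s<q rewrite +-comm s 2 = mk⇔ to
      λ { refl → subst (q ∣_) (sym (m+[n∸m]≡n (<⇒≤ 2<q))) ∣-refl }
      where
      to : q ∣ 2 + s → s ≡ q ∸ 2
      to (divides 1 eq) = cong (_∸ 2) (trans eq (+-identityʳ q))
      to (divides (suc (suc k)) eq) = contradiction
        (≤-trans (+-monoʳ-≤ q (m≤m+n q (k * q))) (≤-reflexive (sym eq)))
        (<⇒≱ (+-mono-< 2<q s<q))

  module _ {q} (2<q : 2 < q) (q-odd : ¬ 2 ∣ q) where

    private
      0<q : 0 < q
      0<q = <-trans z<s 2<q

      q∸2<q : q ∸ 2 < q
      q∸2<q = ∸-monoʳ-< {o = 0} z<s (<⇒≤ 2<q)

      0≢q∸2 : 0 ≢ q ∸ 2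
      0≢q∸2 0≡q∸2 = <⇒≱ 2<q (m∸n≡0⇒m≤n (sym 0≡q∸2))

      2≢q∸2 : 2 ≢ q ∸ 2
      2≢q∸2 2≡q∸2 = q-odd (divides 2 (sym (trans (cong (_+ 2) 2≡q∸2) (m∸n+n≡m (<⇒≤ 2<q)))))

    ∑-unit : ∑[ s < q ] 𝟙 (unit? q s) ≡ q ∸ 1
    ∑-unit = ∑-avoiding q (unit? q) (0 ∷ []) ([] ∷ []) (0<q ∷ []) λ s<q → ∉-[ ∣⇔≡0 s<q ]⇔

    ∑-unit-unit₋ : ∑[ s < q ] 𝟙 (unit-unit₋? q s) ≡ q ∸ 2
    ∑-unit-unit₋ = ∑-avoiding q (unit-unit₋? q) (0 ∷ 2 ∷ []) (((λ ()) ∷ []) ∷ [] ∷ []) (0<q ∷ 2<q ∷ [])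
      λ s<q → ∉-∷⇔ (∣⇔≡0 s<q) ∉-[ ∣∣-2∣⇔≡2 2<q s<q ]⇔

    ∑-unit-unit₊ : ∑[ s < q ] 𝟙 (unit-unit₊? q s) ≡ q ∸ 2
    ∑-unit-unit₊ = ∑-avoiding q (unit-unit₊? q) (0 ∷ q ∸ 2 ∷ []) ((0≢q∸2 ∷ []) ∷ [] ∷ []) (0<q ∷ q∸2<q ∷ [])
      λ s<q → ∉-∷⇔ (∣⇔≡0 s<q) ∉-[ ∣+2⇔≡q∸2 2<q s<q ]⇔

    ∑-unit-unit₋-unit₊ : ∑[ s < q ] 𝟙 (unit-unit₋-unit₊? q s) ≡ q ∸ 3
    ∑-unit-unit₋-unit₊ = ∑-avoiding q (unit-unit₋-unit₊? q) (0 ∷ 2 ∷ q ∸ 2 ∷ [])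
      (((λ ()) ∷ 0≢q∸2 ∷ []) ∷ (2≢q∸2 ∷ []) ∷ [] ∷ []) (0<q ∷ 2<q ∷ q∸2<q ∷ [])
      λ s<q → ∉-∷⇔ (∣⇔≡0 s<q) (∉-∷⇔ (∣∣-2∣⇔≡2 2<q s<q) ∉-[ ∣+2⇔≡q∸2 2<q s<q ]⇔)

  module _ {qs} (primes : All Prime qs) where

    private
      L = 2 ∷ qs
      z = product L
      L-primes : All Prime L
      L-primes = prime[2] ∷ primes

    A? : ∀ x → Dec (0 < x × gcd x z ≡ 1 × 1 < gcd ∣ x - 2 ∣ z × 1 < gcd (x + 2) z)
    A? x = (0 <? x) ×-dec (gcd x z ≟ 1) ×-dec (1 <? gcd ∣ x - 2 ∣ z) ×-dec (1 <? gcd (x + 2) z)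

    A-membership⇔ : ∀ x → (0 < x × gcd x z ≡ 1 × 1 < gcd ∣ x - 2 ∣ z × 1 < gcd (x + 2) z) ⇔
                          (All (λ p → Unit p x) L × ¬ All (λ p → Unit₋ p x) L × ¬ All (λ p → Unit₊ p x) L)
    A-membership⇔ x = mk⇔
      (λ (_ , coprime , u₋ , u₊) → Equivalence.to (gcd≡1⇔All∤ x L-primes) coprime ,
                                   Equivalence.to (1<gcd⇔¬All∤ _ L-primes) u₋ ,
                                   Equivalence.to (1<gcd⇔¬All∤ _ L-primes) u₊)
      (λ { (units@(2∤x ∷ _) , ¬u₋ , ¬u₊) → n≢0⇒n>0 (λ { refl → 2∤x (divides 0 refl) }) ,
                                           Equivalence.from (gcd≡1⇔All∤ x L-primes) units ,
                                           Equivalence.from (1<gcd⇔¬All∤ _ L-primes) ¬u₋ ,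
                                           Equivalence.from (1<gcd⇔¬All∤ _ L-primes) ¬u₊ })

    A-inclusion-exclusion : ∀ x →
      𝟙 (A? x) + 𝟙 (all? (λ p → unit-unit₋? p x) L) + 𝟙 (all? (λ p → unit-unit₊? p x) L)
      ≡ 𝟙 (all? (λ p → unit? p x) L) + 𝟙 (all? (λ p → unit-unit₋-unit₊? p x) L)
    A-inclusion-exclusion x = begin
      𝟙 (A? x) + 𝟙 (all? (λ p → unit-unit₋? p x) L) + 𝟙 (all? (λ p → unit-unit₊? p x) L)
        ≡⟨ cong₂ _+_ (cong₂ _+_ (𝟙-cong (A-membership⇔ x) (A? x) (u ×-dec ¬? u₋ ×-dec ¬? u₊))
                                (𝟙-cong unzip₂ (all? (λ p → unit-unit₋? p x) L) (u ×-dec u₋)))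
                     (𝟙-cong unzip₂ (all? (λ p → unit-unit₊? p x) L) (u ×-dec u₊)) ⟩
      𝟙 (u ×-dec ¬? u₋ ×-dec ¬? u₊) + 𝟙 (u ×-dec u₋) + 𝟙 (u ×-dec u₊)
        ≡⟨ inclusion-exclusion u u₋ u₊ ⟩
      𝟙 u + 𝟙 (u ×-dec u₋ ×-dec u₊)
        ≡⟨ cong (𝟙 u +_) (𝟙-cong zip₃ (u ×-dec u₋ ×-dec u₊) (all? (λ p → unit-unit₋-unit₊? p x) L)) ⟩
      𝟙 u + 𝟙 (all? (λ p → unit-unit₋-unit₊? p x) L) ∎
      where
      open ≡-Reasoning
      u = all? (λ p → unit? p x) L
      u₋ = all? (λ p → unit₋? p x) L
      u₊ = all? (λ p → unit₊? p x) L
      unzip₂ : ∀ {P Q : ℕ → Set} → All (λ p → P p × Q p) L ⇔ (All P L × All Q L)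
      unzip₂ = mk⇔ All.unzip All.zip
      zip₃ : (All (λ p → Unit p x) L × All (λ p → Unit₋ p x) L × All (λ p → Unit₊ p x) L)
             ⇔ All (λ p → Unit p x × Unit₋ p x × Unit₊ p x) L
      zip₃ = mk⇔ (λ (u , u₋ , u₊) → All.zip (u , All.zip (u₋ , u₊)))
                 (λ units → let (u , u₋₊) = All.unzip units in u , All.unzip u₋₊)

  module _ {qs} (primes : All Prime qs) (odd : All (λ q → ¬ 2 ∣ q) qs) (distinct : AllPairs _≢_ qs) where

    private
      L = 2 ∷ qs
      z = product L
      L-primes : All Prime L
      L-primes = prime[2] ∷ primes

    ∑-sieve : ∀ c (C : ℕ → ℕ → Set) (C? : ∀ p → Decidable (C p)) → (∀ {p} → Prime p → Periodic p (C p)) →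
              ∑[ s < 2 ] 𝟙 (C? 2 s) ≡ 1 → (∀ {q} → 2 < q → ¬ 2 ∣ q → ∑[ s < q ] 𝟙 (C? q s) ≡ q ∸ c) →
              ∑[ x < z ] 𝟙 (all? (λ p → C? p x) L) ≡ product (map (_∸ c) qs)
    ∑-sieve c C C? periodic count₂ count = begin
      ∑[ x < z ] 𝟙 (all? (λ p → C? p x) L)
        ≡⟨ ∑-chinese-remainder C C? (All.map prime⇒nonZero L-primes)
             (distinct-primes-coprime L-primes (distinct-with-2 odd distinct)) (All.map periodic L-primes) ⟩
      ∑[ s < 2 ] 𝟙 (C? 2 s) * product (map (λ p → ∑[ s < p ] 𝟙 (C? p s)) qs)
        ≡⟨ cong₂ _*_ count₂ (local-counts primes odd) ⟩
      1 * product (map (_∸ c) qs)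
        ≡⟨ *-identityˡ _ ⟩
      product (map (_∸ c) qs) ∎
      where
      open ≡-Reasoning
      local-counts : ∀ {qs} → All Prime qs → All (λ q → ¬ 2 ∣ q) qs →
                     product (map (λ p → ∑[ s < p ] 𝟙 (C? p s)) qs) ≡ product (map (_∸ c) qs)
      local-counts []                   []             = refl
      local-counts (q-prime ∷ primes) (q-odd ∷ odd) =
        cong₂ _*_ (count (odd-prime⇒2< q-prime q-odd) q-odd) (local-counts primes odd)

    cardA-relation : cardA z + product (map (_∸ 2) qs) + product (map (_∸ 2) qs)
                     ≡ product (map (_∸ 1) qs) + product (map (_∸ 3) qs)
    cardA-relation = begin
      cardA z + product (map (_∸ 2) qs) + product (map (_∸ 2) qs)
        ≡⟨ cong₂ _+_ (cong₂ _+_ (length-filter (A? primes) id z) (sym sieve₋)) (sym sieve₊) ⟩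
      ∑[ x < z ] 𝟙 (A? primes x) + ∑< z f₋ + ∑< z f₊
        ≡⟨ cong (_+ ∑< z f₊) (sym (∑-distrib-+ z (λ x → 𝟙 (A? primes x)) f₋)) ⟩
      ∑[ x < z ] (𝟙 (A? primes x) + f₋ x) + ∑< z f₊
        ≡⟨ sym (∑-distrib-+ z (λ x → 𝟙 (A? primes x) + f₋ x) f₊) ⟩
      ∑[ x < z ] (𝟙 (A? primes x) + f₋ x + f₊ x)
        ≡⟨ ∑-cong z (λ {x} _ → A-inclusion-exclusion primes x) ⟩
      ∑[ x < z ] (f x + f₋₊ x)
        ≡⟨ ∑-distrib-+ z f f₋₊ ⟩
      ∑< z f + ∑< z f₋₊
        ≡⟨ cong₂ _+_ sieve sieve₋₊ ⟩
      product (map (_∸ 1) qs) + product (map (_∸ 3) qs) ∎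
      where
      open ≡-Reasoning
      f f₋ f₊ f₋₊ : ℕ → ℕ
      f   x = 𝟙 (all? (λ p → unit? p x) L)
      f₋  x = 𝟙 (all? (λ p → unit-unit₋? p x) L)
      f₊  x = 𝟙 (all? (λ p → unit-unit₊? p x) L)
      f₋₊ x = 𝟙 (all? (λ p → unit-unit₋-unit₊? p x) L)
      sieve : ∑< z f ≡ product (map (_∸ 1) qs)
      sieve = ∑-sieve 1 _ unit? (λ {p} _ → unit-periodic p) refl ∑-unit
      sieve₋ : ∑< z f₋ ≡ product (map (_∸ 2) qs)
      sieve₋ = ∑-sieve 2 _ unit-unit₋?
        (λ {p} p-prime → periodic-× (unit-periodic p) (unit₋-periodic p {{prime⇒nonZero p-prime}})) refl ∑-unit-unit₋
      sieve₊ : ∑< z f₊ ≡ product (map (_∸ 2) qs)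
      sieve₊ = ∑-sieve 2 _ unit-unit₊? (λ {p} _ → periodic-× (unit-periodic p) (unit₊-periodic p)) refl ∑-unit-unit₊
      sieve₋₊ : ∑< z f₋₊ ≡ product (map (_∸ 3) qs)
      sieve₋₊ = ∑-sieve 3 _ unit-unit₋-unit₊?
        (λ {p} p-prime → periodic-× (unit-periodic p)
                           (periodic-× (unit₋-periodic p {{prime⇒nonZero p-prime}}) (unit₊-periodic p)))
        refl ∑-unit-unit₋-unit₊

  -- Divisor sums and elementary symmetric functions

  ω≡∑ : ∀ y → ω y ≡ ∑[ p < suc y ] 𝟙 (prime? p ×-dec p ∣? y)
  ω≡∑ y = length-filter (λ p → prime? p ×-dec p ∣? y) id (suc y)

  ω-*-prime : ∀ {t q} → Prime q → 0 < t → ¬ q ∣ t → ω (t * q) ≡ suc (ω t)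
  ω-*-prime {t} {q} q-prime 0<t q∤t = begin
    ω (t * q)
      ≡⟨ ω≡∑ (t * q) ⟩
    ∑[ p < suc (t * q) ] 𝟙 (prime? p ×-dec p ∣? t * q)
      ≡⟨ ∑-cong (suc (t * q)) (λ {p} _ → split p) ⟩
    ∑[ p < suc (t * q) ] (𝟙 (prime? p ×-dec p ∣? t) + 𝟙 (p ≟ q))
      ≡⟨ ∑-distrib-+ (suc (t * q)) ω-term (λ p → 𝟙 (p ≟ q)) ⟩
    ∑[ p < suc (t * q) ] 𝟙 (prime? p ×-dec p ∣? t) + ∑[ p < suc (t * q) ] 𝟙 (p ≟ q)
      ≡⟨ cong₂ _+_ (∑-truncate {f = ω-term} (s≤s (m≤m*n t q))
                     λ {p} t<p _ → 𝟙-no (λ (_ , p∣t) → <⇒≱ t<p (∣⇒≤ p∣t)) (prime? p ×-dec p ∣? t))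
                   (∑-𝟙-≟ (suc (t * q)) (s≤s (m≤n*m q t))) ⟩
    ∑[ p < suc t ] 𝟙 (prime? p ×-dec p ∣? t) + 1
      ≡⟨ cong (_+ 1) (sym (ω≡∑ t)) ⟩
    ω t + 1
      ≡⟨ +-comm (ω t) 1 ⟩
    suc (ω t) ∎
    where
    open ≡-Reasoning
    ω-term : ℕ → ℕ
    ω-term p = 𝟙 (prime? p ×-dec p ∣? t)
    instance
      q≢0 : NonZero q
      q≢0 = prime⇒nonZero q-prime
      t≢0 : NonZero t
      t≢0 = >-nonZero 0<t
    split : ∀ p → 𝟙 (prime? p ×-dec p ∣? t * q) ≡ 𝟙 (prime? p ×-dec p ∣? t) + 𝟙 (p ≟ q)
    split p = 𝟙-⊎ (mk⇔ to from) (λ (_ , p∣t) p≡q → q∤t (subst (_∣ t) p≡q p∣t))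
                  (prime? p ×-dec p ∣? t * q) (prime? p ×-dec p ∣? t) (p ≟ q)
      where
      to : Prime p × p ∣ t * q → (Prime p × p ∣ t) ⊎ p ≡ q
      to (p-prime , p∣tq) with euclidsLemma t q p-prime p∣tq
      ... | inj₁ p∣t = inj₁ (p-prime , p∣t)
      ... | inj₂ p∣q = inj₂ ([ (λ p≡1 → contradiction p≡1 (prime≢1 p-prime)) , id ] (prime⇒irreducible q-prime p∣q))
      from : (Prime p × p ∣ t) ⊎ p ≡ q → Prime p × p ∣ t * q
      from (inj₁ (p-prime , p∣t)) = p-prime , ∣m⇒∣m*n q p∣t
      from (inj₂ refl)            = q-prime , n∣m*n t

  RankedDivisor : ℕ → ℕ → ℕ → Set
  RankedDivisor n j y = 0 < y × y ∣ n × ω y ≡ j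

  rankedDivisor? : ∀ n j → Decidable (RankedDivisor n j)
  rankedDivisor? n j y = (0 <? y) ×-dec (y ∣? n) ×-dec (ω y ≟ j)

  divisorSum : ℕ → ℕ → ℕ
  divisorSum n j = ∑[ y < suc n ] (𝟙 (rankedDivisor? n j y) * y)

  divisorSum-extend : ∀ {n m} j → 0 < n → n ≤ m → ∑[ y < suc m ] (𝟙 (rankedDivisor? n j y) * y) ≡ divisorSum n j
  divisorSum-extend {n} j 0<n n≤m = ∑-truncate (s≤s n≤m) λ {y} n<y _ →
    cong (_* y) (𝟙-no (λ (_ , y∣n , _) → <⇒≱ n<y (∣⇒≤ {{>-nonZero 0<n}} y∣n)) (rankedDivisor? n j y))

  N≡divisorSum : ∀ {n} j → 0 < n → ¬ 2 ∣ n → N (2 * n) j ≡ divisorSum n j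
  N≡divisorSum {n} j 0<n 2∤n = begin
    N (2 * n) j
      ≡⟨ sum-filter N? id (suc (2 * n)) ⟩
    ∑[ y < suc (2 * n) ] (𝟙 (N? y) * y)
      ≡⟨ ∑-cong (suc (2 * n)) (λ {y} _ → cong (_* y) (𝟙-cong odd-divisor⇔ (N? y) (rankedDivisor? n j y))) ⟩
    ∑[ y < suc (2 * n) ] (𝟙 (rankedDivisor? n j y) * y)
      ≡⟨ divisorSum-extend j 0<n (m≤n*m n 2) ⟩
    divisorSum n j ∎
    where
    open ≡-Reasoning
    N? : ∀ y → Dec (0 < y × y ∣ 2 * n × ¬ 2 ∣ y × ω y ≡ j)
    N? y = (0 <? y) ×-dec (y ∣? 2 * n) ×-dec ¬? (2 ∣? y) ×-dec (ω y ≟ j)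
    odd-divisor⇔ : ∀ {y} → (0 < y × y ∣ 2 * n × ¬ 2 ∣ y × ω y ≡ j) ⇔ RankedDivisor n j y
    odd-divisor⇔ = mk⇔
      (λ (0<y , y∣2n , 2∤y , ω≡j) → 0<y , coprime-divisor (prime∤⇒coprime prime[2] 2∤y) y∣2n , ω≡j)
      (λ (0<y , y∣n , ω≡j) → 0<y , ∣n⇒∣m*n 2 y∣n , (λ 2∣y → 2∤n (∣-trans 2∣y y∣n)) , ω≡j)

  prev : (ℕ → ℕ) → ℕ → ℕ
  prev f zero    = 0
  prev f (suc j) = f j

  module _ {q n} (q-prime : Prime q) (q∤n : ¬ q ∣ n) (0<n : 0 < n) where

    private instance
      q≢0 : NonZero q
      q≢0 = prime⇒nonZero q-prime

    coprime-part⇔ : ∀ {j y} → (¬ q ∣ y × RankedDivisor (q * n) j y) ⇔ RankedDivisor n j y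
    coprime-part⇔ = mk⇔
      (λ (q∤y , 0<y , y∣qn , ω≡j) → 0<y , coprime-divisor (prime∤⇒coprime q-prime q∤y) y∣qn , ω≡j)
      (λ (0<y , y∣n , ω≡j) → (λ q∣y → q∤n (∣-trans q∣y y∣n)) , 0<y , ∣n⇒∣m*n q y∣n , ω≡j)

    multiple-part : ∀ {j t} → RankedDivisor (q * n) j (t * q) → 0 < t × t ∣ n × ω (t * q) ≡ suc (ω t)
    multiple-part {t = zero}  (() , _)
    multiple-part {t = suc t} (_ , tq∣qn , _) = z<s , t∣n , ω-*-prime q-prime z<s (λ q∣t → q∤n (∣-trans q∣t t∣n))
      where t∣n = *-cancelˡ-∣ q (subst (_∣ q * n) (*-comm (suc t) q) tq∣qn)

    multiple-part⇔ : ∀ {j t} → RankedDivisor (q * n) (suc j) (t * q) ⇔ RankedDivisor n j t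
    multiple-part⇔ {j} {t} = mk⇔
      (λ R@(_ , _ , ω≡1+j) → let (0<t , t∣n , ω-tq) = multiple-part R
                             in 0<t , t∣n , suc-injective (trans (sym ω-tq) ω≡1+j))
      (λ (0<t , t∣n , ω≡j) → *-monoˡ-< q 0<t , subst (_∣ q * n) (*-comm q t) (*-monoʳ-∣ q t∣n) ,
                            trans (ω-*-prime q-prime 0<t λ q∣t → q∤n (∣-trans q∣t t∣n)) (cong suc ω≡j))

    ∑-cofactors : ∀ j → ∑[ t < suc n ] (𝟙 (rankedDivisor? (q * n) j (t * q)) * (t * q)) ≡ q * prev (divisorSum n) j
    ∑-cofactors zero = trans (∑-zero (suc n) λ {t} _ →
        cong (_* (t * q)) (𝟙-no (λ R → 0≢1+n (trans (sym (proj₂ (proj₂ R))) (proj₂ (proj₂ (multiple-part {t = t} R)))))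
                                (rankedDivisor? (q * n) 0 (t * q))))
      (sym (*-zeroʳ q))
    ∑-cofactors (suc j) = trans (∑-cong (suc n) λ {t} _ → begin
        𝟙 (rankedDivisor? (q * n) (suc j) (t * q)) * (t * q)
          ≡⟨ cong₂ _*_ (𝟙-cong multiple-part⇔ (rankedDivisor? (q * n) (suc j) (t * q)) (rankedDivisor? n j t)) (*-comm t q) ⟩
        𝟙 (rankedDivisor? n j t) * (q * t)
          ≡⟨ x*[y*z]≡y*[x*z] (𝟙 (rankedDivisor? n j t)) q t ⟩
        q * (𝟙 (rankedDivisor? n j t) * t) ∎)
      (∑-*ˡ (suc n) q (λ t → 𝟙 (rankedDivisor? n j t) * t))
      where
      open ≡-Reasoning
      x*[y*z]≡y*[x*z] : ∀ x y z → x * (y * z) ≡ y * (x * z)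
      x*[y*z]≡y*[x*z] = solve-∀

    ∑-coprime-part : ∀ j → ∑[ y < suc (q * n) ] (𝟙 (¬? (q ∣? y) ×-dec rankedDivisor? (q * n) j y) * y) ≡ divisorSum n j
    ∑-coprime-part j = trans
      (∑-cong (suc (q * n)) λ {y} _ → cong (_* y)
        (𝟙-cong coprime-part⇔ (¬? (q ∣? y) ×-dec rankedDivisor? (q * n) j y) (rankedDivisor? n j y)))
      (divisorSum-extend j 0<n (m≤n*m n q))

    ∑-multiples-part : ∀ j → ∑[ y < suc (q * n) ] (𝟙 (q ∣? y ×-dec rankedDivisor? (q * n) j y) * y) ≡ q * prev (divisorSum n) j
    ∑-multiples-part j = begin
      ∑< (suc (q * n)) term
        ≡⟨ sym (∑-truncate 1+qn≤[1+n]q λ qn<y _ → beyond qn<y) ⟩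
      ∑< (suc n * q) term
        ≡⟨ ∑-multiples (suc n) q (λ {y} q∤y → cong (_* y) (𝟙-no (q∤y ∘ proj₁) (D? y))) ⟩
      ∑[ t < suc n ] term (t * q)
        ≡⟨ ∑-cong (suc n) (λ {t} _ → cong (_* (t * q)) (𝟙-cong (mk⇔ proj₂ (n∣m*n t ,_)) (D? (t * q)) (R? (t * q)))) ⟩
      ∑[ t < suc n ] (𝟙 (R? (t * q)) * (t * q))
        ≡⟨ ∑-cofactors j ⟩
      q * prev (divisorSum n) j ∎
      where
      open ≡-Reasoning
      R? = rankedDivisor? (q * n) j
      D? : ∀ y → Dec (q ∣ y × RankedDivisor (q * n) j y)
      D? y = q ∣? y ×-dec R? y
      term : ℕ → ℕ
      term y = 𝟙 (D? y) * y
      1+qn≤[1+n]q : suc (q * n) ≤ suc n * q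
      1+qn≤[1+n]q = subst (λ k → suc k ≤ q + n * q) (*-comm n q) (+-monoˡ-≤ (n * q) (>-nonZero⁻¹ q))
      beyond : ∀ {y} → q * n < y → term y ≡ 0
      beyond {y} qn<y = cong (_* y) (𝟙-no (λ (_ , _ , y∣qn , _) → <⇒≱ qn<y (∣⇒≤ {{qn≢0}} y∣qn)) (D? y))
        where qn≢0 = m*n≢0 q n {{q≢0}} {{>-nonZero 0<n}}

    -- A divisor of q n is either prime to q, hence a divisor of n, or t q with t ∣ n and one more prime factor.
    divisorSum-*-prime : ∀ j → divisorSum (q * n) j ≡ divisorSum n j + q * prev (divisorSum n) j
    divisorSum-*-prime j = begin
      ∑[ y < suc (q * n) ] (𝟙 (R? y) * y)
        ≡⟨ ∑-cong (suc (q * n)) (λ {y} _ → trans (cong (_* y) (𝟙-split (q ∣? y) (R? y)))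
                                                 (*-distribʳ-+ y (𝟙 (¬? (q ∣? y) ×-dec R? y)) (𝟙 (q ∣? y ×-dec R? y)))) ⟩
      ∑[ y < suc (q * n) ] (𝟙 (¬? (q ∣? y) ×-dec R? y) * y + 𝟙 (q ∣? y ×-dec R? y) * y)
        ≡⟨ ∑-distrib-+ (suc (q * n)) (λ y → 𝟙 (¬? (q ∣? y) ×-dec R? y) * y) (λ y → 𝟙 (q ∣? y ×-dec R? y) * y) ⟩
      ∑[ y < suc (q * n) ] (𝟙 (¬? (q ∣? y) ×-dec R? y) * y) + ∑[ y < suc (q * n) ] (𝟙 (q ∣? y ×-dec R? y) * y)
        ≡⟨ cong₂ _+_ (∑-coprime-part j) (∑-multiples-part j) ⟩
      divisorSum n j + q * prev (divisorSum n) j ∎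
      where
      open ≡-Reasoning
      R? = rankedDivisor? (q * n) j

  elementary : List ℕ → ℕ → ℕ
  elementary []       zero    = 1
  elementary []       (suc j) = 0
  elementary (q ∷ qs) j       = elementary qs j + q * prev (elementary qs) j

  divisorSum-product : ∀ {qs} j → All Prime qs → AllPairs _≢_ qs → divisorSum (product qs) j ≡ elementary qs j
  divisorSum-product {[]}     zero    _ _ = refl
  divisorSum-product {[]}     (suc j) _ _ = refl
  divisorSum-product {q ∷ qs} j primes@(q-prime ∷ qs-primes) distinct@(_ ∷ qs-distinct)
    with q⊥qs ∷ _ ← distinct-primes-coprime primes distinct = begin
    divisorSum (q * product qs) j
      ≡⟨ divisorSum-*-prime q-prime (coprime⇒∤ q-prime (coprime-product q⊥qs)) (productOfPrimes≥1 qs-primes) j ⟩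
    divisorSum (product qs) j + q * prev (divisorSum (product qs)) j
      ≡⟨ cong₂ (λ a b → a + q * b) (divisorSum-product j qs-primes qs-distinct) (prev-IH j) ⟩
    elementary qs j + q * prev (elementary qs) j ∎
    where
    open ≡-Reasoning
    prev-IH : ∀ j → prev (divisorSum (product qs)) j ≡ prev (elementary qs) j
    prev-IH zero    = refl
    prev-IH (suc j) = divisorSum-product j qs-primes qs-distinct

  elementary-vanishes : ∀ qs {j} → length qs < j → elementary qs j ≡ 0
  elementary-vanishes []       {suc j} _ = refl
  elementary-vanishes (q ∷ qs) {suc j} (s<s |qs|<j)
    rewrite elementary-vanishes qs {suc j} (m<n⇒m<1+n |qs|<j) | elementary-vanishes qs |qs|<j = *-zeroʳ q

  N≡elementary : ∀ {qs} j → All Prime qs → All (λ q → ¬ 2 ∣ q) qs → AllPairs _≢_ qs → N (2 * product qs) j ≡ elementary qs j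
  N≡elementary j primes odd distinct
    with 2⊥qs ∷ _ ← distinct-primes-coprime (prime[2] ∷ primes) (distinct-with-2 odd distinct)
    = trans (N≡divisorSum j (productOfPrimes≥1 primes) (coprime⇒∤ prime[2] (coprime-product 2⊥qs)))
            (divisorSum-product j primes distinct)

module Vieta where

  open import Data.Nat.Base as ℕ using (ℕ; zero; suc; _∸_; _≤_; _<_; s<s)
  import Data.Nat.Properties as ℕ
  open import Data.Integer.Base hiding (suc; _≤_; _<_)
  open import Data.Integer.Properties using (pos-+; pos-*; m-n≡m⊖n; ⊖-≥; *-zeroʳ)
  open import Data.Integer.Tactic.RingSolver using (solve-∀)
  open import Data.List.Base using (foldr)
  open Counting using (elementary; prev; elementary-vanishes; odd-prime⇒2<; cardA-relation; N≡elementary)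
  open import Defs using (cardA; N; a; rhs)
  open import Data.Nat.Primality using (Prime)
  open import Data.Nat.Divisibility using (_∣_)
  open ≡-Reasoning

  ∑< : ℕ → (ℕ → ℤ) → ℤ
  ∑< zero    f = 0ℤ
  ∑< (suc n) f = f 0 + ∑< n (f ∘ suc)

  syntax ∑< n (λ x → e) = ∑[ x < n ] e

  ∑-cong : ∀ n {f g : ℕ → ℤ} → (∀ {x} → x < n → f x ≡ g x) → ∑< n f ≡ ∑< n g
  ∑-cong zero    eq = refl
  ∑-cong (suc n) eq = cong₂ _+_ (eq ℕ.z<s) (∑-cong n (eq ∘ s<s))

  ∑-distrib-+ : ∀ n (f g : ℕ → ℤ) → ∑[ x < n ] (f x + g x) ≡ ∑< n f + ∑< n g
  ∑-distrib-+ zero    f g = refl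
  ∑-distrib-+ (suc n) f g rewrite ∑-distrib-+ n (f ∘ suc) (g ∘ suc) =
    interchange (f 0) (g 0) (∑< n (f ∘ suc)) (∑< n (g ∘ suc))
    where
    interchange : ∀ a b c d → a + b + (c + d) ≡ a + c + (b + d)
    interchange = solve-∀

  ∑-*ˡ : ∀ n c (f : ℕ → ℤ) → ∑[ x < n ] (c * f x) ≡ c * ∑< n f
  ∑-*ˡ zero    c f = sym (*-zeroʳ c)
  ∑-*ˡ (suc n) c f rewrite ∑-*ˡ n c (f ∘ suc) = distrib c (f 0) (∑< n (f ∘ suc))
    where
    distrib : ∀ a b c → a * b + a * c ≡ a * (b + c)
    distrib = solve-∀

  foldr-applyUpTo : ∀ (g : ℕ → ℤ) (f : ℕ → ℕ) n → foldr _+_ 0ℤ (map g (applyUpTo f n)) ≡ ∑[ x < n ] g (f x)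
  foldr-applyUpTo g f zero    = refl
  foldr-applyUpTo g f (suc n) = cong (λ s → g (f 0) + s) (foldr-applyUpTo g (f ∘ suc) n)

  powerSum : ℤ → ℕ → (ℕ → ℤ) → ℤ
  powerSum x m f = ∑[ j < suc m ] (x ^ (m ∸ j) * f j)

  powerSum-cong : ∀ x m {f g : ℕ → ℤ} → (∀ j → f j ≡ g j) → powerSum x m f ≡ powerSum x m g
  powerSum-cong x m eq = ∑-cong (suc m) λ {j} _ → cong (x ^ (m ∸ j) *_) (eq j)

  powerSum-suc : ∀ x m f → powerSum x (suc m) f ≡ x * powerSum x m f + f (suc m)
  powerSum-suc x zero    f = horner x (f 0) (f 1)
    where
    horner : ∀ x a b → x * 1ℤ * a + (1ℤ * b + 0ℤ) ≡ x * (1ℤ * a + 0ℤ) + b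
    horner = solve-∀
  powerSum-suc x (suc m) f rewrite powerSum-suc x m (f ∘ suc) =
    horner x (x ^ suc m) (f 0) (powerSum x m (f ∘ suc)) (f (suc (suc m)))
    where
    horner : ∀ x a b P c → x * a * b + (x * P + c) ≡ x * (a * b + P) + c
    horner = solve-∀

  powerSum-linear : ∀ x m c (f g : ℕ → ℤ) →
                    powerSum x m (λ j → f j + c * g j) ≡ powerSum x m f + c * powerSum x m g
  powerSum-linear x m c f g = begin
    ∑[ j < suc m ] (x ^ (m ∸ j) * (f j + c * g j))
      ≡⟨ ∑-cong (suc m) (λ {j} _ → distrib (x ^ (m ∸ j)) (f j) c (g j)) ⟩
    ∑[ j < suc m ] (x ^ (m ∸ j) * f j + c * (x ^ (m ∸ j) * g j))
      ≡⟨ ∑-distrib-+ (suc m) (λ j → x ^ (m ∸ j) * f j) (λ j → c * (x ^ (m ∸ j) * g j)) ⟩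
    powerSum x m f + ∑[ j < suc m ] (c * (x ^ (m ∸ j) * g j))
      ≡⟨ cong (λ s → powerSum x m f + s) (∑-*ˡ (suc m) c (λ j → x ^ (m ∸ j) * g j)) ⟩
    powerSum x m f + c * powerSum x m g ∎
    where
    distrib : ∀ a b c d → a * (b + c * d) ≡ a * b + c * (a * d)
    distrib = solve-∀

  powerSum-prev : ∀ x m (f : ℕ → ℕ) → powerSum x (suc m) (λ j → + prev f j) ≡ powerSum x m (λ j → + f j)
  powerSum-prev x m f = absorb (x ^ suc m) (powerSum x m (λ j → + f j))
    where
    absorb : ∀ a P → a * 0ℤ + P ≡ P
    absorb = solve-∀

  vieta : ∀ c qs → All (c ℕ.≤_) qs →
          + product (map (_∸ c) qs) ≡ powerSum (- + c) (length qs) (λ j → + elementary qs j)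
  vieta c []       []           = refl
  vieta c (q ∷ qs) (c≤q ∷ c≤qs) = sym (begin
    powerSum x (suc k) (λ j → + elementary (q ∷ qs) j)
      ≡⟨ powerSum-cong x (suc k) (λ j → trans (pos-+ (elementary qs j) _)
                                             (cong (λ s → + elementary qs j + s) (pos-* q (prev (elementary qs) j)))) ⟩
    powerSum x (suc k) (λ j → f j + + q * + prev (elementary qs) j)
      ≡⟨ powerSum-linear x (suc k) (+ q) f (λ j → + prev (elementary qs) j) ⟩
    powerSum x (suc k) f + + q * powerSum x (suc k) (λ j → + prev (elementary qs) j)
      ≡⟨ cong₂ (λ a b → a + + q * b) (powerSum-suc x k f) (powerSum-prev x k (elementary qs)) ⟩
    x * powerSum x k f + f (suc k) + + q * powerSum x k f
      ≡⟨ cong (λ a → x * powerSum x k f + + a + + q * powerSum x k f) (elementary-vanishes qs ℕ.≤-refl) ⟩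
    x * powerSum x k f + 0ℤ + + q * powerSum x k f
      ≡⟨ factor x (+ q) (powerSum x k f) ⟩
    (+ q + x) * powerSum x k f
      ≡⟨ cong₂ _*_ (trans (m-n≡m⊖n q c) (⊖-≥ c≤q)) (sym (vieta c qs c≤qs)) ⟩
    + (q ∸ c) * + product (map (_∸ c) qs)
      ≡⟨ sym (pos-* (q ∸ c) _) ⟩
    + product (map (_∸ c) (q ∷ qs)) ∎)
    where
    x = - + c
    k = length qs
    f : ℕ → ℤ
    f j = + elementary qs j
    factor : ∀ x a P → x * P + 0ℤ + a * P ≡ (a + x) * P
    factor = solve-∀

  neg-^ : ∀ c d → (- + c) ^ d ≡ (- + 1) ^ d * (+ c) ^ d
  neg-^ c zero    = refl
  neg-^ c (suc d) rewrite neg-^ c d = regroup (+ c) ((- + 1) ^ d) ((+ c) ^ d)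
    where
    regroup : ∀ c A B → - c * (A * B) ≡ - + 1 * A * (c * B)
    regroup = solve-∀

  -- With d = k − 2 − j, (−1)^d aⱼ = 9(−3)^d − 8(−2)^d + (−1)^d; two Horner steps lower the degree of
  -- each powerSum from k to k − 2, and the terms in f (k − 1), f k they produce cancel.
  rhs-formula : ∀ n z (f : ℕ → ℤ) → (∀ j → + N z j ≡ f j) →
                rhs n z ≡ powerSum (- + 1) n f + powerSum (- + 3) n f - + 2 * powerSum (- + 2) n f
  rhs-formula zero          z f _ = cancel (f 0)
    where
    cancel : ∀ a → 0ℤ ≡ 1ℤ * a + 0ℤ + (1ℤ * a + 0ℤ) - + 2 * (1ℤ * a + 0ℤ)
    cancel = solve-∀
  rhs-formula (suc zero)    z f _ = cancel (f 0) (f 1)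
    where
    cancel : ∀ a b → 0ℤ ≡ - + 1 * 1ℤ * a + (1ℤ * b + 0ℤ) + (- + 3 * 1ℤ * a + (1ℤ * b + 0ℤ))
                            - + 2 * (- + 2 * 1ℤ * a + (1ℤ * b + 0ℤ))
    cancel = solve-∀
  rhs-formula (suc (suc m)) z f N≡f = begin
    rhs (suc (suc m)) z
      ≡⟨ foldr-applyUpTo (λ j → (- + 1) ^ (m ∸ j) * a (suc (suc m)) j * + N z j) id (suc m) ⟩
    ∑[ j < suc m ] ((- + 1) ^ (m ∸ j) * a (suc (suc m)) j * + N z j)
      ≡⟨ ∑-cong (suc m) (λ j<1+m → expand (ℕ.s≤s⁻¹ j<1+m)) ⟩
    ∑[ j < suc m ] (+ 9 * term₃ j + (- + 8 * term₂ j + term₁ j))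
      ≡⟨ ∑-distrib-+ (suc m) (λ j → + 9 * term₃ j) (λ j → - + 8 * term₂ j + term₁ j) ⟩
    ∑[ j < suc m ] (+ 9 * term₃ j) + ∑[ j < suc m ] (- + 8 * term₂ j + term₁ j)
      ≡⟨ cong₂ _+_ (∑-*ˡ (suc m) (+ 9) term₃)
                   (trans (∑-distrib-+ (suc m) (λ j → - + 8 * term₂ j) term₁)
                          (cong (_+ powerSum (- + 1) m f) (∑-*ˡ (suc m) (- + 8) term₂))) ⟩
    + 9 * powerSum (- + 3) m f + (- + 8 * powerSum (- + 2) m f + powerSum (- + 1) m f)
      ≡⟨ sym (cancel (powerSum (- + 1) m f) (powerSum (- + 2) m f) (powerSum (- + 3) m f) (f (suc m)) (f (suc (suc m)))) ⟩
    (- + 1) * ((- + 1) * powerSum (- + 1) m f + f (suc m)) + f (suc (suc m))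
      + ((- + 3) * ((- + 3) * powerSum (- + 3) m f + f (suc m)) + f (suc (suc m)))
      - + 2 * ((- + 2) * ((- + 2) * powerSum (- + 2) m f + f (suc m)) + f (suc (suc m)))
      ≡⟨ sym (cong₂ (λ a b → a - + 2 * b) (cong₂ _+_ (twice (- + 1)) (twice (- + 3))) (twice (- + 2))) ⟩
    powerSum (- + 1) (suc (suc m)) f + powerSum (- + 3) (suc (suc m)) f - + 2 * powerSum (- + 2) (suc (suc m)) f ∎
    where
    term₁ term₂ term₃ : ℕ → ℤ
    term₁ j = (- + 1) ^ (m ∸ j) * f j
    term₂ j = (- + 2) ^ (m ∸ j) * f j
    term₃ j = (- + 3) ^ (m ∸ j) * f j
    expand : ∀ {j} → j ≤ m → (- + 1) ^ (m ∸ j) * a (suc (suc m)) j * + N z j ≡ + 9 * term₃ j + (- + 8 * term₂ j + term₁ j)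
    expand {j} j≤m = begin
      (- + 1) ^ (m ∸ j) * a (suc (suc m)) j * + N z j
        ≡⟨ cong₂ (λ e F → (- + 1) ^ (m ∸ j) * ((+ 3) ^ e - (+ 2) ^ suc e + + 1) * F) (ℕ.+-∸-assoc 2 j≤m) (N≡f j) ⟩
      A * ((+ 3) ^ (2 ℕ.+ (m ∸ j)) - (+ 2) ^ (3 ℕ.+ (m ∸ j)) + + 1) * f j
        ≡⟨ collect A ((+ 3) ^ (m ∸ j)) ((+ 2) ^ (m ∸ j)) (f j) ⟩
      + 9 * (A * (+ 3) ^ (m ∸ j) * f j) + (- + 8 * (A * (+ 2) ^ (m ∸ j) * f j) + term₁ j)
        ≡⟨ sym (cong₂ (λ B C → + 9 * (B * f j) + (- + 8 * (C * f j) + term₁ j)) (neg-^ 3 (m ∸ j)) (neg-^ 2 (m ∸ j))) ⟩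
      + 9 * term₃ j + (- + 8 * term₂ j + term₁ j) ∎
      where
      A = (- + 1) ^ (m ∸ j)
      collect : ∀ A B C F → A * (+ 3 * (+ 3 * B) - + 2 * (+ 2 * (+ 2 * C)) + + 1) * F
                           ≡ + 9 * (A * B * F) + (- + 8 * (A * C * F) + A * F)
      collect = solve-∀
    twice : ∀ x → powerSum x (suc (suc m)) f ≡ x * (x * powerSum x m f + f (suc m)) + f (suc (suc m))
    twice x = trans (powerSum-suc x (suc m) f) (cong (λ P → x * P + f (suc (suc m))) (powerSum-suc x m f))
    cancel : ∀ P₁ P₂ P₃ f₁ f₂ →
      (- + 1) * ((- + 1) * P₁ + f₁) + f₂ + ((- + 3) * ((- + 3) * P₃ + f₁) + f₂) - + 2 * ((- + 2) * ((- + 2) * P₂ + f₁) + f₂)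
      ≡ + 9 * P₃ + (- + 8 * P₂ + P₁)
    cancel = solve-∀

  pos-isolate : ∀ x b c d → x ℕ.+ b ℕ.+ b ≡ c ℕ.+ d → + x ≡ + c + + d - + 2 * + b
  pos-isolate x b c d eq = begin
    + x
      ≡⟨ isolate (+ x) (+ b) ⟩
    + x + + b + + b - + 2 * + b
      ≡⟨ cong (λ y → y - + 2 * + b) (sym (trans (pos-+ (x ℕ.+ b) b) (cong (_+ + b) (pos-+ x b)))) ⟩
    + (x ℕ.+ b ℕ.+ b) - + 2 * + b
      ≡⟨ cong (λ y → + y - + 2 * + b) eq ⟩
    + (c ℕ.+ d) - + 2 * + b
      ≡⟨ cong (λ y → y - + 2 * + b) (pos-+ c d) ⟩
    + c + + d - + 2 * + b ∎
    where
    isolate : ∀ x b → x ≡ x + b + b - + 2 * b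
    isolate = solve-∀

  cardA-formula : ∀ {qs} z → z ≡ 2 ℕ.* product qs → All Prime qs → All (λ q → ¬ 2 ∣ q) qs → AllPairs _≢_ qs →
                  + cardA z ≡ rhs (length qs) z
  cardA-formula {qs} z refl primes odd distinct = begin
    + cardA z
      ≡⟨ pos-isolate (cardA z) (P 2) (P 1) (P 3) (cardA-relation primes odd distinct) ⟩
    + P 1 + + P 3 - + 2 * + P 2
      ≡⟨ cong₂ (λ a b → a - + 2 * b) (cong₂ _+_ (expand 1 1≤3) (expand 3 ℕ.≤-refl)) (expand 2 2≤3) ⟩
    powerSum (- + 1) k f + powerSum (- + 3) k f - + 2 * powerSum (- + 2) k f
      ≡⟨ sym (rhs-formula k z f (λ j → cong +_ (N≡elementary j primes odd distinct))) ⟩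
    rhs k z ∎
    where
    k = length qs
    P : ℕ → ℕ
    P c = product (map (_∸ c) qs)
    f : ℕ → ℤ
    f j = + elementary qs j
    1≤3 : 1 ℕ.≤ 3
    1≤3 = ℕ.s≤s ℕ.z≤n
    2≤3 : 2 ℕ.≤ 3
    2≤3 = ℕ.s≤s (ℕ.s≤s ℕ.z≤n)
    expand : ∀ c → c ℕ.≤ 3 → + P c ≡ powerSum (- + c) k f
    expand c c≤3 = vieta c qs (All.map (ℕ.≤-trans c≤3) (All.zipWith (uncurry odd-prime⇒2<) (primes , odd)))

open import Defs
open import Data.Nat using (ℕ; _*_)
open import Data.Nat.Divisibility using (_∣_)
open import Data.Nat.Primality using (Prime)
open import Data.List using (tabulate)
open import Data.List.Properties using (length-tabulate)
open import Data.Integer using (+_)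
import Data.List.Relation.Unary.All.Properties as All
import Data.List.Relation.Unary.Unique.Propositional.Properties as Unique
open Vieta using (cardA-formula)

lemma4 : (k : ℕ) (q : Fin k → ℕ)
    → (∀ i → Prime (q i))
    → (∀ i → ¬ (2 ∣ q i))
    → (∀ i j → q i ≡ q j → i ≡ j)
    → (z : ℕ) → z ≡ 2 * product (tabulate q)
    → + cardA z ≡ rhs k z
lemma4 k q primes odd injective z z≡2∏q =
  subst (λ n → + cardA z ≡ rhs n z) (length-tabulate q)
    (cardA-formula z z≡2∏q (All.tabulate⁺ primes) (All.tabulate⁺ odd) (Unique.tabulate⁺ (injective _ _)))
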